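{- Let $x,y\in S_{2\infty}$. Then $t(CS(x,y))=CS(x,y)$, and for every positive integer $i\notin CS(x,y)$: (1) for every $j$, $y(i)=j$ if and only if $x(j)=i$; (2) $i\in S(x)$ if and only if $i\in S(y)$; (3) if $y(i)=j$, then $y(t(i))=t(j)$ and $x(t(j))=t(x(j))$.
   Context: $S_{2\infty}$ denotes the group of permutations of the positive integers fixing all but finitely many integers (the union of the groups $S_{2n}$ on $[2n]$). Couples are $D_i=\{2i-1,2i\}$, $\mathbb{D}=\{D_i:i\ge1\}$, and the partner map $t$ is $t(2i-1)=2i$, $t(2i)=2i-1$; for a set $A$, $t(A)=\{t(a):a\in A\}$. For a permutation $x$: $S(x)=\{i:x(i)\ne i\}$; $D(x)=\{D_i\in\mathbb{D}: x(D_i)\notin\mathbb{D}\}$; $DS(x)=\bigcup_{D_i\in D(x)}D_i$. For a pair $(x,y)$: $DS(x,y)=DS(x)\cup DS(y)$, and the completed support is $CS(x,y)=S(xy)\cup t(S(xy))\cup DS(x,y)$. -}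

module Defs where

open import Data.Nat using (ℕ; zero; suc; _+_; _*_; _∸_; _<_; _≥_)
open import Data.Product using (Σ; ∃; _×_; _,_)
open import Data.Sum using (_⊎_)
open import Relation.Nullary using (¬_)
open import Relation.Binary.PropositionalEquality using (_≡_)
open import Function using (_∘_)

-- Positive integers are encoded as natural numbers k with k ≥ 1;
-- the value 0 is an inert dummy point (fixed by every permutation).

-- S_{2∞}: bijections of the positive integers fixing all but finitely
-- many integers, equivalently lying in some S_{2n} (fixing every k > 2n).
record S2∞ : Set where
  field
    fun     : ℕ → ℕ
    inv     : ℕ → ℕ
    fun-inv : ∀ k → fun (inv k) ≡ k
    inv-fun : ∀ k → inv (fun k) ≡ k
    fix0    : fun 0 ≡ 0
    finite  : ∃ λ n → ∀ k → 2 * n < k → fun k ≡ k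
open S2∞ public

_·_ : S2∞ → S2∞ → S2∞
x · y = record
  { fun = fun x ∘ fun y
  ; inv = inv y ∘ inv x
  ; fun-inv = fi
  ; inv-fun = if
  ; fix0 = f0
  ; finite = fin (finite x) (finite y)
  }
  where
  open import Relation.Binary.PropositionalEquality using (cong; trans)
  fi : ∀ k → fun x (fun y (inv y (inv x k))) ≡ k
  fi k = trans (cong (fun x) (fun-inv y (inv x k))) (fun-inv x k)
  if : ∀ k → inv y (inv x (fun x (fun y k))) ≡ k
  if k = trans (cong (inv y) (inv-fun x (fun y k))) (inv-fun y k)
  f0 : fun x (fun y 0) ≡ 0
  f0 = trans (cong (fun x) (fix0 y)) (fix0 x)
  open import Data.Nat using (_⊔_)
  open import Data.Nat.Properties using (m≤m⊔n; m≤n⊔m; *-monoʳ-≤; ≤-<-trans)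
  fin : (∃ λ n → ∀ k → 2 * n < k → fun x k ≡ k) →
        (∃ λ n → ∀ k → 2 * n < k → fun y k ≡ k) →
        ∃ λ n → ∀ k → 2 * n < k → fun x (fun y k) ≡ k
  fin (a , pa) (b , pb) = a ⊔ b , λ k lt →
    let hy = pb k (≤-<-trans (*-monoʳ-≤ 2 (m≤n⊔m a b)) lt)
        hx = pa k (≤-<-trans (*-monoʳ-≤ 2 (m≤m⊔n a b)) lt)
    in trans (cong (fun x) hy) hx

Subset : Set₁
Subset = ℕ → Set

-- the partner map t : t(2i-1) = 2i, t(2i) = 2i-1  (t 0 = 0 is a dummy value)
t : ℕ → ℕ
t 0 = 0
t 1 = 2
t 2 = 1
t (suc (suc n)) = 2 + t n

tImg : Subset → Subset
tImg A i = ∃ λ a → A a × t a ≡ i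

InCouple : ℕ → ℕ → Set
InCouple i k = i ≥ 1 × (k ≡ 2 * i ∸ 1 ⊎ k ≡ 2 * i)

ImageIsCouple : S2∞ → ℕ → Set
ImageIsCouple x i = ∃ λ j → j ≥ 1 ×
  ((fun x (2 * i ∸ 1) ≡ 2 * j ∸ 1 × fun x (2 * i) ≡ 2 * j)
   ⊎ (fun x (2 * i ∸ 1) ≡ 2 * j × fun x (2 * i) ≡ 2 * j ∸ 1))

Supp : S2∞ → Subset
Supp x i = i ≥ 1 × ¬ (fun x i ≡ i)

InD : S2∞ → ℕ → Set
InD x i = i ≥ 1 × ¬ ImageIsCouple x i

DS : S2∞ → Subset
DS x k = ∃ λ i → InD x i × InCouple i k

DS₂ : S2∞ → S2∞ → Subset
DS₂ x y k = DS x k ⊎ DS y k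

CS : S2∞ → S2∞ → Subset
CS x y k = Supp (x · y) k ⊎ tImg (Supp (x · y)) k ⊎ DS₂ x y k

_≐_ : Subset → Subset → Set
A ≐ B = (∀ k → A k → B k) × (∀ k → B k → A k)

module Submission where

-- Everything rests on two facts about the partner map t:
-- it is an involution, and it swaps the two members 2c-1, 2c of each
-- couple D_c.
--  * A set A with A ⊆ t⁻¹(A) ("t-closed") satisfies t(A) = A, because t
--    is an involution.  S ∪ t(S) is t-closed for any S, and DS(x) is
--    t-closed because it is a union of couples; hence CS(x,y) is t-closed.
--  * For i ∉ CS(x,y) three local facts hold: xy fixes i (i ∉ S(xy)),
--    xy fixes t(i) (i ∉ t(S(xy))), and y(t i) = t(y i), since the couple
--    of i is mapped by y onto a couple (i ∉ DS(y)) and a permutation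
--    mapping a partner pair onto a partner pair commutes with t there.
--    Membership in CS is not decidable, but equality of naturals is, so
--    these follow from ¬ CS by stability of decidable propositions.
--  * Claims (1)-(3) are then purely about permutations: if x(y i) = i then
--    y(i) = j ⟺ x(j) = i and S(x), S(y) agree at i; together with the
--    facts at t(i), x commutes with t at y(i).

open import Defs
open import Data.Nat using (ℕ; zero; suc; _+_; _*_; _∸_; _≥_; s≤s; z≤n)
open import Data.Nat.Properties using (_≟_; *-suc)
open import Data.Product using (∃; _×_; _,_)
open import Data.Sum using (_⊎_; inj₁; inj₂)
open import Relation.Nullary using (¬_)
open import Relation.Nullary.Decidable using (decidable-stable)
open import Relation.Binary.PropositionalEquality
  using (_≡_; refl; sym; trans; cong; subst; module ≡-Reasoning)
open import Function.Bundles using (_⇔_; mk⇔)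

open ≡-Reasoning

t-positive : ∀ k → k ≥ 1 → t k ≥ 1
t-positive (suc zero)          _ = s≤s z≤n
t-positive (suc (suc zero))    _ = s≤s z≤n
t-positive (suc (suc (suc k))) _ = s≤s z≤n

t-shift : ∀ n → n ≥ 1 → t (2 + n) ≡ 2 + t n
t-shift (suc n) _ = refl

t-involutive : ∀ k → t (t k) ≡ k
t-involutive zero             = refl
t-involutive (suc zero)       = refl
t-involutive (suc (suc zero)) = refl
t-involutive (suc (suc (suc k))) = begin
  t (2 + t (suc k))  ≡⟨ t-shift (t (suc k)) (t-positive (suc k) (s≤s z≤n)) ⟩
  2 + t (t (suc k))  ≡⟨ cong (2 +_) (t-involutive (suc k)) ⟩
  3 + k              ∎

t-even : ∀ c → c ≥ 1 → t (2 * c) ≡ 2 * c ∸ 1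
t-even (suc zero)    _ = refl
t-even (suc (suc c)) _ = begin
  t (2 * suc (suc c))    ≡⟨ cong t (*-suc 2 (suc c)) ⟩
  2 + t (2 * suc c)      ≡⟨ cong (2 +_) (t-even (suc c) (s≤s z≤n)) ⟩
  2 + (2 * suc c ∸ 1)    ≡⟨ cong (_∸ 1) (sym (*-suc 2 (suc c))) ⟩
  2 * suc (suc c) ∸ 1    ∎

t-odd : ∀ c → c ≥ 1 → t (2 * c ∸ 1) ≡ 2 * c
t-odd c c≥1 = trans (cong t (sym (t-even c c≥1))) (t-involutive (2 * c))

InCouple-t : ∀ {c k} → InCouple c k → InCouple c (t k)
InCouple-t {c} (c≥1 , inj₁ refl) = c≥1 , inj₂ (t-odd c c≥1)
InCouple-t {c} (c≥1 , inj₂ refl) = c≥1 , inj₁ (t-even c c≥1)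

InCouple-next : ∀ {c k} → InCouple c k → InCouple (suc c) (2 + k)
InCouple-next {suc c} (_ , inj₁ refl) =
  s≤s z≤n , inj₁ (cong (_∸ 1) (sym (*-suc 2 (suc c))))
InCouple-next {suc c} (_ , inj₂ refl) =
  s≤s z≤n , inj₂ (sym (*-suc 2 (suc c)))

couple-of : ∀ k → k ≥ 1 → ∃ λ c → InCouple c k
couple-of (suc zero)          _ = 1 , s≤s z≤n , inj₁ refl
couple-of (suc (suc zero))    _ = 1 , s≤s z≤n , inj₂ refl
couple-of (suc (suc (suc k))) _ with couple-of (suc k) (s≤s z≤n)
... | c , k∈D = suc c , InCouple-next k∈D

TClosed : Subset → Set
TClosed A = ∀ k → A k → A (t k)

tImg-closed : ∀ {A} → TClosed A → tImg A ≐ A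
tImg-closed closed =
  (λ { _ (a , a∈A , refl) → closed a a∈A }) ,
  (λ k k∈A → t k , closed k k∈A , t-involutive k)

⊎-closed : ∀ {A B} → TClosed A → TClosed B → TClosed (λ k → A k ⊎ B k)
⊎-closed closedA _ k (inj₁ k∈A) = inj₁ (closedA k k∈A)
⊎-closed _ closedB k (inj₂ k∈B) = inj₂ (closedB k k∈B)

saturation-closed : ∀ {A B} → TClosed B → TClosed (λ k → A k ⊎ tImg A k ⊎ B k)
saturation-closed _ k (inj₁ k∈A) = inj₂ (inj₁ (k , k∈A , refl))
saturation-closed {A} _ _ (inj₂ (inj₁ (a , a∈A , refl))) =
  inj₁ (subst A (sym (t-involutive a)) a∈A)
saturation-closed closedB k (inj₂ (inj₂ k∈B)) = inj₂ (inj₂ (closedB k k∈B))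

DS-closed : (x : S2∞) → TClosed (DS x)
DS-closed x k (c , D∈D , k∈D) = c , D∈D , InCouple-t k∈D

CS-closed : (x y : S2∞) → TClosed (CS x y)
CS-closed x y = saturation-closed (⊎-closed (DS-closed x) (DS-closed y))

fun-injective : (x : S2∞) → ∀ {a b} → fun x a ≡ fun x b → a ≡ b
fun-injective x {a} {b} e = begin
  a                ≡⟨ sym (inv-fun x a) ⟩
  inv x (fun x a)  ≡⟨ cong (inv x) e ⟩
  inv x (fun x b)  ≡⟨ inv-fun x b ⟩
  b                ∎

pair-commutes : (x : S2∞) → ∀ {p q} → fun x p ≡ q → fun x (t p) ≡ t q →
                ∀ k → k ≡ p ⊎ k ≡ t p → fun x (t k) ≡ t (fun x k)
pair-commutes x xp xtp k (inj₁ refl) = trans xtp (cong t (sym xp))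
pair-commutes x {p} {q} xp xtp k (inj₂ refl) = begin
  fun x (t (t p))   ≡⟨ cong (fun x) (t-involutive p) ⟩
  fun x p           ≡⟨ xp ⟩
  q                 ≡⟨ sym (t-involutive q) ⟩
  t (t q)           ≡⟨ cong t (sym xtp) ⟩
  t (fun x (t p))   ∎

couple-members : ∀ {c k} → InCouple c k → k ≡ 2 * c ∸ 1 ⊎ k ≡ t (2 * c ∸ 1)
couple-members (_ , inj₁ e) = inj₁ e
couple-members {c} (c≥1 , inj₂ e) = inj₂ (trans e (sym (t-odd c c≥1)))

couple-commutes : (x : S2∞) → ∀ {c k} → ImageIsCouple x c → InCouple c k →
                  fun x (t k) ≡ t (fun x k)
couple-commutes x {c} {k} (j , j≥1 , inj₁ (odd↦odd , even↦even)) k∈D@(c≥1 , _) =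
  pair-commutes x odd↦odd
    (trans (cong (fun x) (t-odd c c≥1)) (trans even↦even (sym (t-odd j j≥1))))
    k (couple-members k∈D)
couple-commutes x {c} {k} (j , j≥1 , inj₂ (odd↦even , even↦odd)) k∈D@(c≥1 , _) =
  pair-commutes x odd↦even
    (trans (cong (fun x) (t-odd c c≥1)) (trans even↦odd (sym (t-even j j≥1))))
    k (couple-members k∈D)

inverse-at : (x y : S2∞) → ∀ {i} → fun x (fun y i) ≡ i →
             ∀ j → (fun y i ≡ j) ⇔ (fun x j ≡ i)
inverse-at x y {i} xyi j = mk⇔
  (λ { refl → xyi })
  (λ xj → fun-injective x (trans xyi (sym xj)))

support-agrees : (x y : S2∞) → ∀ {i} → fun x (fun y i) ≡ i → Supp x i ⇔ Supp y i
support-agrees x y {i} xyi = mk⇔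
  (λ { (i≥1 , x-moves) → i≥1 , λ yi → x-moves (trans (cong (fun x) (sym yi)) xyi) })
  (λ { (i≥1 , y-moves) → i≥1 , λ xi → y-moves (fun-injective x (trans xyi (sym xi))) })

x-commutes-at : (x y : S2∞) → ∀ {i} → fun x (fun y i) ≡ i →
                fun x (fun y (t i)) ≡ t i → fun y (t i) ≡ t (fun y i) →
                fun x (t (fun y i)) ≡ t (fun x (fun y i))
x-commutes-at x y {i} xyi xyti yti = begin
  fun x (t (fun y i))   ≡⟨ cong (fun x) (sym yti) ⟩
  fun x (fun y (t i))   ≡⟨ xyti ⟩
  t i                   ≡⟨ cong t (sym xyi) ⟩
  t (fun x (fun y i))   ∎

-- Outside CS(x,y), the three local facts used above hold.  Each is an
-- equation of naturals, hence stable, so it follows from ¬ CS.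
module Outside (x y : S2∞) {i : ℕ} (i≥1 : i ≥ 1) (i∉CS : ¬ CS x y i) where

  xy-fixes : fun x (fun y i) ≡ i
  xy-fixes = decidable-stable (_ ≟ _) (λ moves → i∉CS (inj₁ (i≥1 , moves)))

  xy-fixes-partner : fun x (fun y (t i)) ≡ t i
  xy-fixes-partner = decidable-stable (_ ≟ _) λ moves →
    i∉CS (inj₂ (inj₁ (t i , (t-positive i i≥1 , moves) , t-involutive i)))

  y-commutes : fun y (t i) ≡ t (fun y i)
  y-commutes with couple-of i i≥1
  ... | c , i∈D@(c≥1 , _) = decidable-stable (_ ≟ _) λ fails →
    i∉CS (inj₂ (inj₂ (inj₂ (c , (c≥1 , λ image → fails (couple-commutes y image i∈D)) , i∈D))))

lemma2p7 : (x y : S2∞) →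
    (tImg (CS x y) ≐ CS x y) ×
    (∀ i → i ≥ 1 → ¬ CS x y i →
      ((∀ j → j ≥ 1 → (fun y i ≡ j) ⇔ (fun x j ≡ i)) ×
       (Supp x i ⇔ Supp y i) ×
       (∀ j → fun y i ≡ j → (fun y (t i) ≡ t j) × (fun x (t j) ≡ t (fun x j)))))
lemma2p7 x y = tImg-closed (CS-closed x y) , outside
  where
  outside : ∀ i → i ≥ 1 → ¬ CS x y i →
      ((∀ j → j ≥ 1 → (fun y i ≡ j) ⇔ (fun x j ≡ i)) ×
       (Supp x i ⇔ Supp y i) ×
       (∀ j → fun y i ≡ j → (fun y (t i) ≡ t j) × (fun x (t j) ≡ t (fun x j))))
  outside i i≥1 i∉CS =
    (λ j _ → inverse-at x y xy-fixes j) ,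
    support-agrees x y xy-fixes ,
    λ { _ refl → y-commutes , x-commutes-at x y xy-fixes xy-fixes-partner y-commutes }
    where open Outside x y i≥1 i∉CS
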